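{- Let $S$ be an S-tree, let $c\in\operatorname{Core}(S)$, and let $v$ be a new vertex not in $V(S)$. Then the tree $S+_{s}\{c,v\}$ with vertex set $V(S)\cup\{v\}$ and edge set $E(S)\cup\{\{c,v\}\}$ is an S-tree.
   Context: For a tree $S$, $\mathcal{N}(S)$ is the null space of its adjacency matrix and $\operatorname{Supp}(S)=\{w\in V(S): x_w\neq0\text{ for some }x\in\mathcal{N}(S)\}$. $S$ is an S-tree if $N[\operatorname{Supp}(S)]=V(S)$, where $N[X]=\bigcup_{w\in X}(N(w)\cup\{w\})$. $\operatorname{Core}(S)=\bigcup_{w\in\operatorname{Supp}(S)}N(w)$.
   Formalization: The null vectors in $\mathcal{N}(S)$ that define supports, for S and for the extended tree, have rational entries instead of real ones. -}

module Defs where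

open import Data.Nat using (ℕ; zero; suc; _+_; _*_; _∸_; _≥_)
open import Data.Fin using (Fin; zero; suc)
open import Data.Fin.Properties using () renaming (_≟_ to _≟ᶠ_)
open import Data.Bool using (Bool; true; false; if_then_else_)
open import Data.Rational using (ℚ; 0ℚ; 1ℚ) renaming (_+_ to _+ℚ_; _*_ to _*ℚ_)
open import Data.Product using (Σ; _×_; ∃)
open import Data.Sum using (_⊎_)
open import Relation.Nullary using (¬_)
open import Relation.Nullary.Decidable using (⌊_⌋)
open import Relation.Binary.PropositionalEquality using (_≡_)

Graph : ℕ → Set
Graph n = Fin n → Fin n → Bool

sumℕ : ∀ {n} → (Fin n → ℕ) → ℕ
sumℕ {zero}  f = 0
sumℕ {suc n} f = f zero + sumℕ (λ i → f (suc i))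

sumℚ : ∀ {n} → (Fin n → ℚ) → ℚ
sumℚ {zero}  f = 0ℚ
sumℚ {suc n} f = f zero +ℚ sumℚ (λ i → f (suc i))

b2ℕ : Bool → ℕ
b2ℕ true  = 1
b2ℕ false = 0

data Walk {n} (G : Graph n) : Fin n → Fin n → Set where
  here : ∀ {i} → Walk G i i
  step : ∀ {i k j} → G i k ≡ true → Walk G k j → Walk G i j

record IsTree {n} (G : Graph n) : Set where
  field
    nonempty  : n ≥ 1
    symmetric : ∀ i j → G i j ≡ G j i
    loopless  : ∀ i → G i i ≡ false
    connected : ∀ i j → Walk G i j
    edgeCount : sumℕ (λ i → sumℕ (λ j → b2ℕ (G i j))) ≡ 2 * (n ∸ 1)

adjMat : ∀ {n} → Graph n → Fin n → Fin n → ℚ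
adjMat G i j = if G i j then 1ℚ else 0ℚ

InNullSpace : ∀ {n} → Graph n → (Fin n → ℚ) → Set
InNullSpace {n} G x = ∀ i → sumℚ (λ j → adjMat G i j *ℚ x j) ≡ 0ℚ

InSupp : ∀ {n} → Graph n → Fin n → Set
InSupp G w = Σ (_ → ℚ) λ x → InNullSpace G x × ¬ (x w ≡ 0ℚ)

InCore : ∀ {n} → Graph n → Fin n → Set
InCore G c = ∃ λ w → InSupp G w × G w c ≡ true

IsSTree : ∀ {n} → Graph n → Set
IsSTree {n} G = IsTree G × (∀ u → ∃ λ w → InSupp G w × (w ≡ u ⊎ G w u ≡ true))

-- S +_s {c, v}: new vertex v = zero, old vertex i becomes suc i.
addLeaf : ∀ {n} → Graph n → Fin n → Graph (suc n)
addLeaf G c zero    zero    = false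
addLeaf G c zero    (suc j) = ⌊ j ≟ᶠ c ⌋
addLeaf G c (suc i) zero    = ⌊ i ≟ᶠ c ⌋
addLeaf G c (suc i) (suc j) = G i j

module Submission where

-- The tree axioms for S + {c, v} are bookkeeping (one new vertex, one new edge).
-- The point is the domination condition N[Supp] = V, which follows from two facts
-- about a tree S with a support vertex w (witnessed by x with A x = 0, x_w ≠ 0)
-- adjacent to c:
--   (1) x_w·e_c = A y for a vector y with y_c = 0 (hanging-vector): root S at c and
--       let y be x on the odd layers of the branch hanging at w, 0 elsewhere;
--   (2) hence every null vector z of S vanishes at c, since
--       x_w z_c = ⟨A y, z⟩ = ⟨y, A z⟩ = 0 (core-vanishes).
-- A vector (t, z) is null for S + {c, v} when z_c = 0 and A z = −t e_c (leaf-null), so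
-- by (2) every old support vertex stays in the support, and by (1) (−x_w, y) puts v
-- in the support.
-- The branch structure needs the fact that the parent edges of a breadth-first
-- layering exhaust the edges of a tree, proved by counting: there are n − 1 of each.

open import Defs
open import Algebra.Bundles using (CommutativeMonoid; Ring)
import Algebra.Properties.CommutativeMonoid.Sum as MonoidSum
import Algebra.Properties.Semiring.Sum as SemiringSum
open import Data.Nat using (ℕ; zero; suc; _+_; _*_; _∸_; _≤_; z≤n; s≤s; parity)
import Data.Nat.Properties as ℕ
open import Data.Fin using (Fin; zero; suc; punchIn)
open import Data.Fin.Properties using (_≟_; punchInᵢ≢i; any?)
open import Data.Rational using (ℚ; 0ℚ; 1ℚ; -_; 1/_; ≢-nonZero) renaming (_+_ to _+ℚ_; _*_ to _*ℚ_)
import Data.Rational.Properties as ℚ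
open import Data.Parity using (0ℙ; 1ℙ; _⁻¹)
import Data.Parity.Properties as ℙ
open import Data.Bool using (true; false; if_then_else_)
import Data.Bool.Properties as Bool
open import Data.Vec.Functional using (replicate; _∷_)
open import Data.Product using (Σ; _×_; _,_; proj₁; proj₂; ∃)
open import Data.Sum using (_⊎_; inj₁; inj₂)
open import Data.Empty using (⊥; ⊥-elim)
open import Relation.Nullary using (¬_; yes; no)
open import Relation.Nullary.Decidable using (Dec; ⌊_⌋; _⊎-dec_; _×-dec_; ¬?; isYes≗does; dec-true; dec-false)
open import Relation.Nullary.Negation using (contradiction)
open import Relation.Unary using (Decidable)
open import Relation.Binary.PropositionalEquality
  using (_≡_; _≢_; refl; sym; trans; cong; cong₂; subst; module ≡-Reasoning)

module _ {a ℓ} (M : CommutativeMonoid a ℓ) where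
  open CommutativeMonoid M
  open MonoidSum M

  sum-single : ∀ {n} (f : Fin n → Carrier) k → (∀ i → i ≢ k → f i ≈ ε) → sum f ≈ f k
  sum-single {suc n} f k vanish = begin
    sum f                          ≈⟨ sum-remove f ⟩
    f k ∙ sum (λ i → f (punchIn k i)) ≈⟨ ∙-congˡ (sum-cong-≋ (λ i → vanish _ (punchInᵢ≢i k i))) ⟩
    f k ∙ sum (replicate n ε)      ≈⟨ ∙-congˡ (sum-replicate-zero n) ⟩
    f k ∙ ε                        ≈⟨ identityʳ (f k) ⟩
    f k                            ∎
    where open import Relation.Binary.Reasoning.Setoid setoid

module ΣN = MonoidSum ℕ.+-0-commutativeMonoid
module ΣQ = SemiringSum (Ring.semiring ℚ.+-*-ring)

sumℕ-is-sum : ∀ {n} (f : Fin n → ℕ) → sumℕ f ≡ ΣN.sum f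
sumℕ-is-sum {zero}  f = refl
sumℕ-is-sum {suc n} f = cong (f zero +_) (sumℕ-is-sum (λ i → f (suc i)))

sumℚ-is-sum : ∀ {n} (f : Fin n → ℚ) → sumℚ f ≡ ΣQ.sum f
sumℚ-is-sum {zero}  f = refl
sumℚ-is-sum {suc n} f = cong (f zero +ℚ_) (sumℚ-is-sum (λ i → f (suc i)))

+-tight : ∀ {a b c d} → a ≤ b → c ≤ d → a + c ≡ b + d → a ≡ b × c ≡ d
+-tight {a} {b} a≤b c≤d eq = a≡b , ℕ.+-cancelˡ-≡ a _ _ (trans eq (cong (_+ _) (sym a≡b)))
  where
  a≡b : a ≡ b
  a≡b = ℕ.≤-antisym a≤b (ℕ.≮⇒≥ (λ a<b → ℕ.<-irrefl eq (ℕ.+-mono-<-≤ a<b c≤d)))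

sum-mono : ∀ {n} {f g : Fin n → ℕ} → (∀ i → f i ≤ g i) → ΣN.sum f ≤ ΣN.sum g
sum-mono {zero}  le = z≤n
sum-mono {suc n} le = ℕ.+-mono-≤ (le zero) (sum-mono (λ i → le (suc i)))

sum-tight : ∀ {n} {f g : Fin n → ℕ} → (∀ i → f i ≤ g i) → ΣN.sum f ≡ ΣN.sum g → ∀ i → f i ≡ g i
sum-tight {suc n} le eq zero    = proj₁ (+-tight (le zero) (sum-mono (λ i → le (suc i))) eq)
sum-tight {suc n} le eq (suc i) = sum-tight (λ j → le (suc j)) (proj₂ (+-tight (le zero) (sum-mono (λ j → le (suc j))) eq)) i

≟-diag : ∀ {n} (k : Fin n) → ⌊ k ≟ k ⌋ ≡ true
≟-diag k = trans (isYes≗does (k ≟ k)) (dec-true (k ≟ k) refl)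

≟-off : ∀ {n} {i k : Fin n} → i ≢ k → ⌊ i ≟ k ⌋ ≡ false
≟-off {i = i} {k} i≢k = trans (isYes≗does (i ≟ k)) (dec-false (i ≟ k) i≢k)

sum-ones : ∀ n → ΣN.sum {n} (λ _ → 1) ≡ n
sum-ones zero    = refl
sum-ones (suc n) = cong suc (sum-ones n)

indicator-sum : ∀ {n} (k : Fin n) → ΣN.sum (λ i → b2ℕ ⌊ i ≟ k ⌋) ≡ 1
indicator-sum k = trans (sum-single ℕ.+-0-commutativeMonoid (λ i → b2ℕ ⌊ i ≟ k ⌋) k (λ i i≢k → cong b2ℕ (≟-off i≢k)))
                        (cong b2ℕ (≟-diag k))

count-others : ∀ {n} (k : Fin n) → ΣN.sum (λ i → b2ℕ ⌊ ¬? (i ≟ k) ⌋) ≡ n ∸ 1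
count-others {n} k = begin
  others                                                       ≡⟨ ℕ.m+n∸n≡m others 1 ⟨
  others + 1 ∸ 1                                               ≡⟨ cong (λ m → others + m ∸ 1) (indicator-sum k) ⟨
  others + ΣN.sum (λ i → b2ℕ ⌊ i ≟ k ⌋) ∸ 1                    ≡⟨ cong (_∸ 1) (ΣN.∑-distrib-+ (λ i → b2ℕ ⌊ ¬? (i ≟ k) ⌋) (λ i → b2ℕ ⌊ i ≟ k ⌋)) ⟨
  ΣN.sum (λ i → b2ℕ ⌊ ¬? (i ≟ k) ⌋ + b2ℕ ⌊ i ≟ k ⌋) ∸ 1        ≡⟨ cong (_∸ 1) (ΣN.sum-cong-≗ (λ i → complement (i ≟ k))) ⟩
  ΣN.sum {n} (λ _ → 1) ∸ 1                                       ≡⟨ cong (_∸ 1) (sum-ones n) ⟩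
  n ∸ 1                                                        ∎
  where
  open ≡-Reasoning
  others = ΣN.sum (λ i → b2ℕ ⌊ ¬? (i ≟ k) ⌋)
  complement : ∀ {A : Set} (d : Dec A) → b2ℕ ⌊ ¬? d ⌋ + b2ℕ ⌊ d ⌋ ≡ 1
  complement (yes _) = refl
  complement (no _)  = refl

edge-sum : ∀ {n} (G : Graph n) → sumℕ (λ i → sumℕ (λ j → b2ℕ (G i j))) ≡ ΣN.sum (λ i → ΣN.sum (λ j → b2ℕ (G i j)))
edge-sum G = trans (sumℕ-is-sum (λ i → sumℕ (λ j → b2ℕ (G i j)))) (ΣN.sum-cong-≗ (λ i → sumℕ-is-sum (λ j → b2ℕ (G i j))))

rowSum : ∀ {n} → Graph n → (Fin n → ℚ) → Fin n → ℚ
rowSum G f i = ΣQ.sum (λ j → adjMat G i j *ℚ f j)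

null-rows : ∀ {n} (G : Graph n) {x} → InNullSpace G x → ∀ i → rowSum G x i ≡ 0ℚ
null-rows G {x} nx i = trans (sym (sumℚ-is-sum (λ j → adjMat G i j *ℚ x j))) (nx i)

rows-null : ∀ {n} (G : Graph n) {x} → (∀ i → rowSum G x i ≡ 0ℚ) → InNullSpace G x
rows-null G {x} rows i = trans (sumℚ-is-sum (λ j → adjMat G i j *ℚ x j)) (rows i)

point : ∀ {n} → Fin n → ℚ → Fin n → ℚ
point k a i = if ⌊ i ≟ k ⌋ then a else 0ℚ

point-at : ∀ {n} (k : Fin n) a → point k a k ≡ a
point-at k a = cong (λ b → if b then a else 0ℚ) (≟-diag k)

point-off : ∀ {n} {k i : Fin n} a → i ≢ k → point k a i ≡ 0ℚ
point-off a i≢k = cong (λ b → if b then a else 0ℚ) (≟-off i≢k)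

point-zero : ∀ {n} (k i : Fin n) → point k 0ℚ i ≡ 0ℚ
point-zero k i with ⌊ i ≟ k ⌋
... | true  = refl
... | false = refl

sum-point : ∀ {n} (k : Fin n) (a : ℚ) (f : Fin n → ℚ) → ΣQ.sum (λ j → point k a j *ℚ f j) ≡ a *ℚ f k
sum-point k a f = trans (sum-single ℚ.+-0-commutativeMonoid (λ j → point k a j *ℚ f j) k off) (cong (_*ℚ f k) (point-at k a))
  where
  off : ∀ j → j ≢ k → point k a j *ℚ f j ≡ 0ℚ
  off j j≢k = trans (cong (_*ℚ f j) (point-off a j≢k)) (ℚ.*-zeroˡ (f j))

row-cong : ∀ {n} (G : Graph n) {f g} i → (∀ j → G i j ≡ true → f j ≡ g j) → rowSum G f i ≡ rowSum G g i
row-cong G i agree = ΣQ.sum-cong-≗ (λ j → term (G i j) (agree j))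
  where
  term : ∀ b {p q} → (b ≡ true → p ≡ q) → (if b then 1ℚ else 0ℚ) *ℚ p ≡ (if b then 1ℚ else 0ℚ) *ℚ q
  term true          h = cong (1ℚ *ℚ_) (h refl)
  term false {p} {q} h = trans (ℚ.*-zeroˡ p) (sym (ℚ.*-zeroˡ q))

row-zero : ∀ {n} (G : Graph n) i → rowSum G (λ _ → 0ℚ) i ≡ 0ℚ
row-zero {n} G i = trans (ΣQ.sum-cong-≗ (λ j → ℚ.*-zeroʳ (adjMat G i j))) (ΣQ.sum-replicate-zero n)

row-point : ∀ {n} (G : Graph n) {i k} a → G i k ≡ true → rowSum G (point k a) i ≡ a
row-point G {i} {k} a ik = begin
  rowSum G (point k a) i                ≡⟨ ΣQ.sum-cong-≗ (λ j → ℚ.*-comm (adjMat G i j) (point k a j)) ⟩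
  ΣQ.sum (λ j → point k a j *ℚ adjMat G i j) ≡⟨ sum-point k a (adjMat G i) ⟩
  a *ℚ adjMat G i k                     ≡⟨ cong (λ b → a *ℚ (if b then 1ℚ else 0ℚ)) ik ⟩
  a *ℚ 1ℚ                               ≡⟨ ℚ.*-identityʳ a ⟩
  a                                     ∎
  where open ≡-Reasoning

pairing : ∀ {n} {G : Graph n} → (∀ i j → G i j ≡ G j i) → ∀ y z →
          ΣQ.sum (λ i → z i *ℚ rowSum G y i) ≡ ΣQ.sum (λ j → y j *ℚ rowSum G z j)
pairing {G = G} sym-G y z = begin
  ΣQ.sum (λ i → z i *ℚ rowSum G y i)                          ≡⟨ ΣQ.sum-cong-≗ (λ i → ΣQ.*-distribˡ-sum (z i) (λ j → adjMat G i j *ℚ y j)) ⟩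
  ΣQ.sum (λ i → ΣQ.sum (λ j → z i *ℚ (adjMat G i j *ℚ y j))) ≡⟨ ΣQ.∑-comm (λ i j → z i *ℚ (adjMat G i j *ℚ y j)) ⟩
  ΣQ.sum (λ j → ΣQ.sum (λ i → z i *ℚ (adjMat G i j *ℚ y j))) ≡⟨ ΣQ.sum-cong-≗ (λ j → ΣQ.sum-cong-≗ (λ i → swap i j)) ⟩
  ΣQ.sum (λ j → ΣQ.sum (λ i → y j *ℚ (adjMat G j i *ℚ z i))) ≡⟨ ΣQ.sum-cong-≗ (λ j → ΣQ.*-distribˡ-sum (y j) (λ i → adjMat G j i *ℚ z i)) ⟨
  ΣQ.sum (λ j → y j *ℚ rowSum G z j)                          ∎
  where
  open ≡-Reasoning
  swap : ∀ i j → z i *ℚ (adjMat G i j *ℚ y j) ≡ y j *ℚ (adjMat G j i *ℚ z i)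
  swap i j = begin
    z i *ℚ (adjMat G i j *ℚ y j) ≡⟨ ℚ.*-assoc (z i) _ (y j) ⟨
    (z i *ℚ adjMat G i j) *ℚ y j ≡⟨ ℚ.*-comm _ (y j) ⟩
    y j *ℚ (z i *ℚ adjMat G i j) ≡⟨ cong (y j *ℚ_) (ℚ.*-comm (z i) _) ⟩
    y j *ℚ (adjMat G i j *ℚ z i) ≡⟨ cong (λ b → y j *ℚ ((if b then 1ℚ else 0ℚ) *ℚ z i)) (sym-G i j) ⟩
    y j *ℚ (adjMat G j i *ℚ z i) ∎

cancel-nonzero : ∀ {a b} → b *ℚ a ≡ 0ℚ → b ≢ 0ℚ → a ≡ 0ℚ
cancel-nonzero {a} {b} ba≡0 b≢0 = begin
  a                  ≡⟨ ℚ.*-identityˡ a ⟨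
  1ℚ *ℚ a            ≡⟨ cong (_*ℚ a) (ℚ.*-inverseˡ b) ⟨
  (1/ b *ℚ b) *ℚ a   ≡⟨ ℚ.*-assoc (1/ b) b a ⟩
  1/ b *ℚ (b *ℚ a)   ≡⟨ cong (1/ b *ℚ_) ba≡0 ⟩
  1/ b *ℚ 0ℚ         ≡⟨ ℚ.*-zeroʳ (1/ b) ⟩
  0ℚ                 ∎
  where
  open ≡-Reasoning
  instance _ = ≢-nonZero b≢0

record Least (P : ℕ → Set) : Set where
  field
    value   : ℕ
    holds   : P value
    minimal : ∀ {k} → P k → value ≤ k

least : ∀ {P : ℕ → Set} → Decidable P → ∀ {m} → P m → Least P
least P? {zero} p0 = record { value = 0 ; holds = p0 ; minimal = λ _ → z≤n }
least {P} P? {suc m} pm with P? 0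
... | yes p0 = record { value = 0 ; holds = p0 ; minimal = λ _ → z≤n }
... | no ¬p0 = record { value = suc (Least.value l) ; holds = Least.holds l ; minimal = minimal }
  where
  l : Least (λ k → P (suc k))
  l = least (λ k → P? (suc k)) pm
  minimal : ∀ {k} → P k → suc (Least.value l) ≤ k
  minimal {zero}  p0 = ⊥-elim (¬p0 p0)
  minimal {suc k} pk = s≤s (Least.minimal l pk)

record Layering {n} (G : Graph n) (root : Fin n) : Set where
  field
    depth        : Fin n → ℕ
    parent       : Fin n → Fin n
    depth-root   : depth root ≡ 0
    parent-adj   : ∀ {u} → u ≢ root → G u (parent u) ≡ true
    parent-depth : ∀ {u} → u ≢ root → depth u ≡ suc (depth (parent u))

  depth-zero : ∀ {u} → depth u ≡ 0 → u ≡ root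
  depth-zero {u} d≡0 with u ≟ root
  ... | yes u≡root = u≡root
  ... | no u≢root  = contradiction (trans (sym d≡0) (parent-depth u≢root)) λ ()

  ancestor : ℕ → Fin n → Fin n
  ancestor zero    u = u
  ancestor (suc k) u = ancestor k (parent u)

  -- The ancestor of u in the first layer (the root is its own top).
  top : Fin n → Fin n
  top u = ancestor (depth u ∸ 1) u

  top-root : top root ≡ root
  top-root rewrite depth-root = refl

  top-parent : ∀ {u} → u ≢ root → (parent u ≡ root × top u ≡ u) ⊎ top u ≡ top (parent u)
  top-parent {u} u≢root with depth (parent u) in dp | parent-depth u≢root
  ... | zero  | du rewrite du = inj₁ (depth-zero dp , refl)
  ... | suc m | du rewrite du = inj₂ refl

module BreadthFirst {n} (G : Graph n) (root : Fin n) where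

  Near : ℕ → Fin n → Set
  Near zero    u = u ≡ root
  Near (suc k) u = Near k u ⊎ ∃ λ j → G u j ≡ true × Near k j

  near? : ∀ k u → Dec (Near k u)
  near? zero    u = u ≟ root
  near? (suc k) u = near? k u ⊎-dec any? (λ j → (G u j Bool.≟ true) ×-dec near? k j)

  walk-near : ∀ {u} → Walk G u root → ∃ λ k → Near k u
  walk-near here = 0 , refl
  walk-near (step {k = j} e w) = suc (proj₁ (walk-near w)) , inj₂ (j , e , proj₂ (walk-near w))

  layering : (∀ u → Walk G u root) → Layering G root
  layering reach = record
    { depth        = depth
    ; parent       = parent
    ; depth-root   = ℕ.n≤0⇒n≡0 (Least.minimal (distance root) refl)
    ; parent-adj   = parent-adj
    ; parent-depth = parent-depth
    }
    where
    distance : ∀ u → Least (λ k → Near k u)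
    distance u = least (λ k → near? k u) (proj₂ (walk-near (reach u)))

    depth : Fin n → ℕ
    depth u = Least.value (distance u)

    closer : ∀ {u} → u ≢ root → (l : Least (λ k → Near k u)) → ∃ λ j → G u j ≡ true × Least.value l ≡ suc (depth j)
    closer u≢root record { value = zero ; holds = u≡root } = ⊥-elim (u≢root u≡root)
    closer u≢root record { value = suc k ; holds = inj₁ near ; minimal = min } = ⊥-elim (ℕ.<-irrefl refl (min near))
    closer u≢root record { value = suc k ; holds = inj₂ (j , e , near) ; minimal = min } =
      j , e , ℕ.≤-antisym (min (inj₂ (j , e , Least.holds (distance j)))) (s≤s (Least.minimal (distance j) near))

    parent : Fin n → Fin n
    parent u with u ≟ root
    ... | yes _     = root
    ... | no u≢root = proj₁ (closer u≢root (distance u))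

    parent-adj : ∀ {u} → u ≢ root → G u (parent u) ≡ true
    parent-adj {u} u≢root with u ≟ root
    ... | yes u≡root = ⊥-elim (u≢root u≡root)
    ... | no u≢root′ = proj₁ (proj₂ (closer u≢root′ (distance u)))

    parent-depth : ∀ {u} → u ≢ root → depth u ≡ suc (depth (parent u))
    parent-depth {u} u≢root with u ≟ root
    ... | yes u≡root = ⊥-elim (u≢root u≡root)
    ... | no u≢root′ = proj₂ (proj₂ (closer u≢root′ (distance u)))

-- In a tree, the parent edges of any layering are all the edges: there are n - 1 of
-- them, no edge is used twice, and the tree has only n - 1 edges.
module TreeLayering {n} {S : Graph n} (tree : IsTree S) {root} (L : Layering S root) where
  open IsTree tree
  open Layering L

  ParentEdge : Fin n → Fin n → Set
  ParentEdge a b = a ≢ root × b ≡ parent a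

  parentEdge? : ∀ a b → Dec (ParentEdge a b)
  parentEdge? a b = ¬? (a ≟ root) ×-dec (b ≟ parent a)

  π : Fin n → Fin n → ℕ
  π a b = b2ℕ ⌊ parentEdge? a b ⌋

  no-two-cycle : ∀ {a b} → ParentEdge a b → ParentEdge b a → ⊥
  no-two-cycle {a} (a≢root , refl) (pa≢root , a≡ppa) = ℕ.m≢1+n+m (depth a) {1} (begin
    depth a                           ≡⟨ parent-depth a≢root ⟩
    suc (depth (parent a))            ≡⟨ cong suc (parent-depth pa≢root) ⟩
    suc (suc (depth (parent (parent a)))) ≡⟨ cong (λ v → suc (suc (depth v))) a≡ppa ⟨
    suc (suc (depth a))               ∎)
    where open ≡-Reasoning

  parent-edges≤edges : ∀ a b → π a b + π b a ≤ b2ℕ (S a b)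
  parent-edges≤edges a b with parentEdge? a b | parentEdge? b a
  ... | yes ab | yes ba = ⊥-elim (no-two-cycle ab ba)
  ... | yes (a≢root , refl) | no _ rewrite parent-adj a≢root = s≤s z≤n
  ... | no _ | yes (b≢root , refl) rewrite symmetric a b | parent-adj b≢root = s≤s z≤n
  ... | no _ | no _ = z≤n

  parent-edge-count : ΣN.sum (λ a → ΣN.sum (λ b → π a b)) ≡ n ∸ 1
  parent-edge-count = trans (ΣN.sum-cong-≗ out-degree) (count-others root)
    where
    out-degree : ∀ a → ΣN.sum (λ b → π a b) ≡ b2ℕ ⌊ ¬? (a ≟ root) ⌋
    out-degree a with a ≟ root
    ... | yes _ = ΣN.sum-replicate-zero n
    ... | no a≢root = trans (ΣN.sum-cong-≗ same) (indicator-sum (parent a))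
      where
      same : ∀ b → b2ℕ ⌊ ¬? (no a≢root) ×-dec (b ≟ parent a) ⌋ ≡ b2ℕ ⌊ b ≟ parent a ⌋
      same b = cong b2ℕ (trans (isYes≗does (¬? (no a≢root) ×-dec (b ≟ parent a))) (sym (isYes≗does (b ≟ parent a))))

  -- Both directions together count every edge twice, as does the degree sum of a tree.
  parent-edges≡edges : ΣN.sum (λ a → ΣN.sum (λ b → π a b + π b a)) ≡ ΣN.sum (λ a → ΣN.sum (λ b → b2ℕ (S a b)))
  parent-edges≡edges = begin
    ΣN.sum (λ a → ΣN.sum (λ b → π a b + π b a))                   ≡⟨ ΣN.sum-cong-≗ (λ a → ΣN.∑-distrib-+ (π a) (λ b → π b a)) ⟩
    ΣN.sum (λ a → ΣN.sum (π a) + ΣN.sum (λ b → π b a))            ≡⟨ ΣN.∑-distrib-+ (λ a → ΣN.sum (π a)) (λ a → ΣN.sum (λ b → π b a)) ⟩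
    ΣN.sum (λ a → ΣN.sum (π a)) + ΣN.sum (λ a → ΣN.sum (λ b → π b a)) ≡⟨ cong (ΣN.sum (λ a → ΣN.sum (π a)) +_) (ΣN.∑-comm (λ a b → π b a)) ⟩
    ΣN.sum (λ a → ΣN.sum (π a)) + ΣN.sum (λ b → ΣN.sum (π b))     ≡⟨ cong₂ _+_ parent-edge-count parent-edge-count ⟩
    (n ∸ 1) + (n ∸ 1)                                             ≡⟨ cong ((n ∸ 1) +_) (ℕ.+-identityʳ (n ∸ 1)) ⟨
    2 * (n ∸ 1)                                                   ≡⟨ edgeCount ⟨
    sumℕ (λ a → sumℕ (λ b → b2ℕ (S a b)))                         ≡⟨ edge-sum S ⟩
    ΣN.sum (λ a → ΣN.sum (λ b → b2ℕ (S a b)))                     ∎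
    where open ≡-Reasoning

  edge-is-parent-edge : ∀ {a b} → S a b ≡ true → ParentEdge a b ⊎ ParentEdge b a
  edge-is-parent-edge {a} {b} ab = decide (parentEdge? a b) (parentEdge? b a) tight
    where
    tight : π a b + π b a ≡ b2ℕ (S a b)
    tight = sum-tight (parent-edges≤edges a)
              (sum-tight (λ a′ → sum-mono (parent-edges≤edges a′)) parent-edges≡edges a) b
    decide : (p : Dec (ParentEdge a b)) (q : Dec (ParentEdge b a)) →
             b2ℕ ⌊ p ⌋ + b2ℕ ⌊ q ⌋ ≡ b2ℕ (S a b) → ParentEdge a b ⊎ ParentEdge b a
    decide (yes p) _       _ = inj₁ p
    decide (no _)  (yes q) _ = inj₂ q
    decide (no _)  (no _)  0≡edge rewrite ab = contradiction 0≡edge λ ()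

  edge-parity : ∀ {a b} → S a b ≡ true → parity (depth a) ≡ parity (depth b) ⁻¹
  edge-parity {a} {b} ab with edge-is-parent-edge ab
  ... | inj₁ (a≢root , refl) = trans (cong parity (parent-depth a≢root)) (sym (ℙ.⁻¹-selfInverse (ℙ.suc-homo-⁻¹ (depth (parent a)))))
  ... | inj₂ (b≢root , refl) = trans (sym (ℙ.suc-homo-⁻¹ (depth (parent b)))) (cong (λ d → parity d ⁻¹) (sym (parent-depth b≢root)))

-- The branch hanging from a child w of the root: vertices whose first-layer ancestor is w.
-- The only edge leaving it is the edge w — root.
module Branch {n} {S : Graph n} (tree : IsTree S) {root} (L : Layering S root)
              {w} (w~root : S w root ≡ true) where
  open IsTree tree
  open Layering L
  open TreeLayering tree L

  w≢root : w ≢ root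
  w≢root refl = contradiction (trans (sym w~root) (loopless root)) λ ()

  parent-w : parent w ≡ root
  parent-w with edge-is-parent-edge w~root
  ... | inj₁ (_ , root≡pw)      = sym root≡pw
  ... | inj₂ (root≢root , _)    = ⊥-elim (root≢root refl)

  depth-w : depth w ≡ 1
  depth-w = begin
    depth w               ≡⟨ parent-depth w≢root ⟩
    suc (depth (parent w)) ≡⟨ cong (λ v → suc (depth v)) parent-w ⟩
    suc (depth root)      ≡⟨ cong suc depth-root ⟩
    1                     ∎
    where open ≡-Reasoning

  top-w : top w ≡ w
  top-w rewrite depth-w = refl

  top-root≢w : top root ≢ w
  top-root≢w t = w≢root (trans (sym t) top-root)

  leave-branch : ∀ {i j} → S i j ≡ true → top i ≡ w → top j ≢ w → i ≡ w × j ≡ root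
  leave-branch ij ti tj with edge-is-parent-edge ij
  leave-branch ij ti tj | inj₁ (i≢root , refl) with top-parent i≢root
  ... | inj₁ (pi≡root , ti≡i) = trans (sym ti≡i) ti , pi≡root
  ... | inj₂ ti≡tpi           = ⊥-elim (tj (trans (sym ti≡tpi) ti))
  leave-branch ij ti tj | inj₂ (j≢root , refl) with top-parent j≢root
  ... | inj₁ (pj≡root , _) = ⊥-elim (top-root≢w (subst (λ v → top v ≡ w) pj≡root ti))
  ... | inj₂ tj≡tpj        = ⊥-elim (tj (trans tj≡tpj ti))

  Kept : Fin n → Set
  Kept u = top u ≡ w × parity (depth u) ≡ 1ℙ

  kept? : ∀ u → Dec (Kept u)
  kept? u = (top u ≟ w) ×-dec (parity (depth u) ℙ.≟ 1ℙ)

  w-kept : Kept w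
  w-kept = top-w , cong parity depth-w

  restrict : (Fin n → ℚ) → Fin n → ℚ
  restrict x u = if ⌊ kept? u ⌋ then x u else 0ℚ

  restrict-kept : ∀ x {u} → Kept u → restrict x u ≡ x u
  restrict-kept x {u} k with kept? u
  ... | yes _  = refl
  ... | no ¬k  = ⊥-elim (¬k k)

  restrict-dropped : ∀ x {u} → ¬ Kept u → restrict x u ≡ 0ℚ
  restrict-dropped x {u} ¬k with kept? u
  ... | yes k  = ⊥-elim (¬k k)
  ... | no _   = refl

  restrict-root : ∀ x → restrict x root ≡ 0ℚ
  restrict-root x = restrict-dropped x (λ k → top-root≢w (proj₁ k))

  module _ (x : Fin n → ℚ) (nx : InNullSpace S x) where
    y : Fin n → ℚ
    y = restrict x

    -- At the root only w contributes.
    row-root : rowSum S y root ≡ x w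
    row-root = trans (row-cong S root only-w) (row-point S (x w) (trans (symmetric root w) w~root))
      where
      only-w : ∀ j → S root j ≡ true → y j ≡ point w (x w) j
      only-w j root~j with j ≟ w
      ... | yes refl = restrict-kept x w-kept
      ... | no j≢w   = restrict-dropped x λ k →
                         j≢w (proj₁ (leave-branch (trans (symmetric j root) root~j) (proj₁ k) top-root≢w))

    -- Outside the branch (and away from the root) no neighbour is kept.
    row-outside : ∀ {i} → i ≢ root → top i ≢ w → rowSum S y i ≡ 0ℚ
    row-outside {i} i≢root ti = trans (row-cong S i none) (row-zero S i)
      where
      none : ∀ j → S i j ≡ true → y j ≡ 0ℚ
      none j i~j = restrict-dropped x λ k →
                     i≢root (proj₂ (leave-branch (trans (symmetric j i) i~j) (proj₁ k) ti))

    -- On an even layer of the branch every neighbour is kept, so the row is that of x.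
    row-even : ∀ {i} → top i ≡ w → parity (depth i) ≡ 0ℙ → rowSum S y i ≡ 0ℚ
    row-even {i} ti even = trans (row-cong S i all) (null-rows S nx i)
      where
      all : ∀ j → S i j ≡ true → y j ≡ x j
      all j i~j = restrict-kept x (top-j , odd-j)
        where
        odd-j : parity (depth j) ≡ 1ℙ
        odd-j = trans (edge-parity (trans (symmetric j i) i~j)) (cong _⁻¹ even)
        top-j : top j ≡ w
        top-j with top j ≟ w
        ... | yes tj = tj
        ... | no tj  = contradiction (trans (sym even) (trans (cong (λ v → parity (depth v)) i≡w) (proj₂ w-kept))) λ ()
          where
          -- i would be w, which lies on an odd layer
          i≡w : i ≡ w
          i≡w = proj₁ (leave-branch i~j ti tj)

    -- On an odd layer every neighbour lies on an even layer.
    row-odd : ∀ {i} → parity (depth i) ≡ 1ℙ → rowSum S y i ≡ 0ℚ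
    row-odd {i} odd = trans (row-cong S i none) (row-zero S i)
      where
      none : ∀ j → S i j ≡ true → y j ≡ 0ℚ
      none j i~j = restrict-dropped x λ k →
        contradiction (trans (sym (proj₂ k)) (trans (edge-parity (trans (symmetric j i) i~j)) (cong _⁻¹ odd))) λ ()

    restrict-rows : ∀ i → rowSum S y i ≡ point root (x w) i
    restrict-rows i with i ≟ root
    ... | yes refl = row-root
    ... | no i≢root with top i ≟ w | parity (depth i) in p
    ...   | no ti  | _  = row-outside i≢root ti
    ...   | yes ti | 0ℙ = row-even ti p
    ...   | yes _  | 1ℙ = row-odd p

-- If w ~ c in a tree and A x = 0, then x_w·e_c = A y for some y vanishing at c
-- (y is x restricted to the odd layers of the branch at w, seen from the root c).
hanging-vector : ∀ {n} {S : Graph n} {c w} {x : Fin n → ℚ} → IsTree S → S w c ≡ true → InNullSpace S x →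
                 Σ (Fin n → ℚ) λ y → y c ≡ 0ℚ × (∀ i → rowSum S y i ≡ point c (x w) i)
hanging-vector {S = S} {c} {x = x} tree w~c nx = restrict x , restrict-root x , restrict-rows x nx
  where open Branch tree (BreadthFirst.layering S c (λ u → IsTree.connected tree u c)) w~c

-- In a tree every null vector vanishes on the core: x_w z_c = ⟨A y, z⟩ = ⟨y, A z⟩ = 0.
core-vanishes : ∀ {n} {S : Graph n} {c} {z : Fin n → ℚ} → IsTree S → InCore S c → InNullSpace S z → z c ≡ 0ℚ
core-vanishes {n} {S} {c} {z} tree (w , (x , nx , xw≢0) , w~c) nz with hanging-vector tree w~c nx
... | y , _ , Ay = cancel-nonzero xw·zc≡0 xw≢0
  where
  open ≡-Reasoning
  xw·zc≡0 : x w *ℚ z c ≡ 0ℚ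
  xw·zc≡0 = begin
    x w *ℚ z c                            ≡⟨ sum-point c (x w) z ⟨
    ΣQ.sum (λ i → point c (x w) i *ℚ z i) ≡⟨ ΣQ.sum-cong-≗ (λ i → trans (cong (_*ℚ z i) (sym (Ay i))) (ℚ.*-comm _ (z i))) ⟩
    ΣQ.sum (λ i → z i *ℚ rowSum S y i)    ≡⟨ pairing (IsTree.symmetric tree) y z ⟩
    ΣQ.sum (λ j → y j *ℚ rowSum S z j)    ≡⟨ ΣQ.sum-cong-≗ (λ j → trans (cong (y j *ℚ_) (null-rows S nz j)) (ℚ.*-zeroʳ (y j))) ⟩
    ΣQ.sum {n} (λ _ → 0ℚ)                 ≡⟨ ΣQ.sum-replicate-zero n ⟩
    0ℚ                                    ∎

two-more : ∀ {n} → Fin n → 2 + 2 * (n ∸ 1) ≡ 2 * n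
two-more {suc m} _ = sym (ℕ.*-suc 2 m)

module Leaf {n} (S : Graph n) (c : Fin n) where
  S′ : Graph (suc n)
  S′ = addLeaf S c

  lift-walk : ∀ {i j} → Walk S i j → Walk S′ (suc i) (suc j)
  lift-walk here       = here
  lift-walk (step e p) = step e (lift-walk p)

  walk-to-leaf : ∀ {i} → Walk S i c → Walk S′ (suc i) zero
  walk-to-leaf here       = step (≟-diag c) here
  walk-to-leaf (step e p) = step e (walk-to-leaf p)

  leaf-tree : IsTree S → IsTree S′
  leaf-tree tree = record
    { nonempty  = s≤s z≤n
    ; symmetric = symmetric′
    ; loopless  = loopless′
    ; connected = connected′
    ; edgeCount = edgeCount′
    }
    where
    open IsTree tree
    symmetric′ : ∀ i j → S′ i j ≡ S′ j i
    symmetric′ zero    zero    = refl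
    symmetric′ zero    (suc j) = refl
    symmetric′ (suc i) zero    = refl
    symmetric′ (suc i) (suc j) = symmetric i j

    loopless′ : ∀ i → S′ i i ≡ false
    loopless′ zero    = refl
    loopless′ (suc i) = loopless i

    connected′ : ∀ i j → Walk S′ i j
    connected′ zero    zero    = here
    connected′ zero    (suc j) = step (≟-diag c) (lift-walk (connected c j))
    connected′ (suc i) zero    = walk-to-leaf (connected i c)
    connected′ (suc i) (suc j) = lift-walk (connected i j)

    -- The leaf row contributes 1, the new column 1, the old rows 2 (n - 1).
    edgeCount′ : sumℕ (λ i → sumℕ (λ j → b2ℕ (S′ i j))) ≡ 2 * n
    edgeCount′ = begin
      sumℕ (λ j → b2ℕ ⌊ j ≟ c ⌋) + sumℕ (λ i → b2ℕ ⌊ i ≟ c ⌋ + old i)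
        ≡⟨ cong₂ _+_ (sumℕ-is-sum (λ j → b2ℕ ⌊ j ≟ c ⌋)) (sumℕ-is-sum (λ i → b2ℕ ⌊ i ≟ c ⌋ + old i)) ⟩
      ΣN.sum (λ j → b2ℕ ⌊ j ≟ c ⌋) + ΣN.sum (λ i → b2ℕ ⌊ i ≟ c ⌋ + old i)
        ≡⟨ cong (ΣN.sum (λ j → b2ℕ ⌊ j ≟ c ⌋) +_) (ΣN.∑-distrib-+ (λ i → b2ℕ ⌊ i ≟ c ⌋) old) ⟩
      ΣN.sum (λ j → b2ℕ ⌊ j ≟ c ⌋) + (ΣN.sum (λ i → b2ℕ ⌊ i ≟ c ⌋) + ΣN.sum old)
        ≡⟨ cong₂ (λ p q → p + (q + ΣN.sum old)) (indicator-sum c) (indicator-sum c) ⟩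
      2 + ΣN.sum old
        ≡⟨ cong (2 +_) (trans (sym (sumℕ-is-sum old)) edgeCount) ⟩
      2 + 2 * (n ∸ 1)
        ≡⟨ two-more c ⟩
      2 * n ∎
      where
      open ≡-Reasoning
      old : Fin n → ℕ
      old i = sumℕ (λ j → b2ℕ (S i j))

  leaf-null : ∀ {z : Fin n → ℚ} {a} → z c ≡ 0ℚ → (∀ i → rowSum S z i ≡ point c a i) →
              InNullSpace S′ ((- a) ∷ z)
  leaf-null {z} {a} zc≡0 Az = rows-null S′ {(- a) ∷ z} rows
    where
    open ≡-Reasoning
    rows : ∀ i → rowSum S′ ((- a) ∷ z) i ≡ 0ℚ
    rows zero = begin
      0ℚ *ℚ (- a) +ℚ ΣQ.sum (λ j → point c 1ℚ j *ℚ z j) ≡⟨ cong₂ _+ℚ_ (ℚ.*-zeroˡ (- a)) (sum-point c 1ℚ z) ⟩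
      0ℚ +ℚ 1ℚ *ℚ z c                                   ≡⟨ cong (λ q → 0ℚ +ℚ 1ℚ *ℚ q) zc≡0 ⟩
      0ℚ +ℚ 1ℚ *ℚ 0ℚ                                    ≡⟨⟩
      0ℚ                                                ∎
    rows (suc i) = trans (cong (point c 1ℚ i *ℚ (- a) +ℚ_) (Az i)) (cancel i)
      where
      cancel : ∀ i → point c 1ℚ i *ℚ (- a) +ℚ point c a i ≡ 0ℚ
      cancel i with i ≟ c
      ... | yes _ = trans (cong (_+ℚ a) (ℚ.*-identityˡ (- a))) (ℚ.+-inverseˡ a)
      ... | no _  = cong (_+ℚ 0ℚ) (ℚ.*-zeroˡ (- a))

mainTheorem12 : ∀ {n : ℕ} (S : Graph n) (c : Fin n) →
    IsSTree S → InCore S c → IsSTree (addLeaf S c)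
mainTheorem12 S c (tree , dominated) core@(w , (x , nx , xw≢0) , w~c) = leaf-tree tree , dominated′
  where
  open Leaf S c

  -- The new leaf v carries the entry −x_w of the null vector (−x_w, y).
  leaf-supported : InSupp S′ zero
  leaf-supported with hanging-vector tree w~c nx
  ... | y , y-c≡0 , Ay = (- x w) ∷ y , leaf-null y-c≡0 Ay , λ −xw≡0 → xw≢0 (ℚ.neg-injective −xw≡0)

  -- Old null vectors vanish at c, hence extend by 0 at v.
  lift-supported : ∀ {u} → InSupp S u → InSupp S′ (suc u)
  lift-supported (z , nz , zu≢0) =
    (- 0ℚ) ∷ z , leaf-null (core-vanishes tree core nz) (λ i → trans (null-rows S nz i) (sym (point-zero c i))) , zu≢0

  dominated′ : ∀ u → ∃ λ w′ → InSupp S′ w′ × (w′ ≡ u ⊎ S′ w′ u ≡ true)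
  dominated′ zero    = zero , leaf-supported , inj₁ refl
  dominated′ (suc u) with dominated u
  ... | w′ , supported , inj₁ w′≡u = suc w′ , lift-supported supported , inj₁ (cong suc w′≡u)
  ... | w′ , supported , inj₂ w′~u = suc w′ , lift-supported supported , inj₂ w′~u
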